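{- Fix $3\leq m\leq n$, and let $(\mathbf d,\mathbf r)$ be any smooth arithmetical structure on $D_m$. The number of arithmetical structures on $D_n$ that are descendants of $(\mathbf d,\mathbf r)$ is $B(n-3,n-m)$, where $B(j,k)=\frac{j-k+1}{j+1}\binom{j+k}{j}$.
   Context: For $n\ge 3$ let $\ell=n-3$. The bident $D_n$ has vertices $v_x,v_y,v_0,\dots,v_\ell$ and edges $v_xv_0$, $v_yv_0$, $v_iv_{i+1}$ ($0\le i\le\ell-1$). An arithmetical structure on $D_n$ is a pair $(\mathbf d,\mathbf r)$, $\mathbf d=(d_x,d_y,d_0,\dots,d_\ell)$, $\mathbf r=(r_x,r_y,r_0,\dots,r_\ell)$, of positive integer vectors with $(\operatorname{diag}(\mathbf d)-A)\mathbf r=\mathbf 0$ ($A$ the adjacency matrix) and $\mathbf r$ primitive. It is smooth if $d_x,d_y,d_1,\dots,d_\ell\ge2$. Subdivision at position $i$ ($1\le i\le\ell+1$) turns an arithmetical structure on $D_n$ into one $(\mathbf d',\mathbf r')$ on $D_{n+1}$ as follows. For $1\le i\le \ell$: $r'_j=r_j$ for $j\in\{x,y,0,\dots,i-1\}$, $r'_i=r_{i-1}+r_i$, $r'_j=r_{j-1}$ for $i+1\le j\le \ell+1$; $d'_j=d_j$ for $j\in\{x,y,0,\dots,i-2\}$, $d'_{i-1}=d_{i-1}+1$, $d'_i=1$, $d'_{i+1}=d_i+1$, $d'_j=d_{j-1}$ for $i+2\le j\le\ell+1$. For $i=\ell+1$: $r'_j=r_j$ for $j\in\{x,y,0,\dots,\ell\}$,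 $r'_{\ell+1}=r_\ell$; $d'_j=d_j$ for $j\in\{x,y,0,\dots,\ell-1\}$, $d'_\ell=d_\ell+1$, $d'_{\ell+1}=1$. (Here index $0$ plays the role of $i-1$ when $i=1$.) An arithmetical structure on $D_n$ is a descendant of one on $D_m$ if it is obtained from it by a finite sequence of such subdivisions (the empty sequence allowed). -}

module Defs where

open import Data.Nat using (ℕ; zero; suc; _+_; _*_; _∸_; _≤_; _<_; _/_)
open import Data.Nat.Divisibility using (_∣_)
open import Data.Nat.Combinatorics using (_C_)
open import Data.Fin using (Fin; zero; suc)
open import Data.Vec using (Vec; []; _∷_)
open import Data.Vec.Relation.Unary.All using (All)
open import Data.Product using (_×_)
open import Data.Unit using (⊤)
open import Relation.Binary.PropositionalEquality using (_≡_)

-- A pair (d , r) of vectors indexed by the vertices of the bident D_n,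
-- where ℓ = n - 3.  The path part d_0..d_ℓ / r_0..r_ℓ is a Vec of length ℓ+1.
record Struct (ℓ : ℕ) : Set where
  constructor mkStruct
  field
    dx dy : ℕ
    d     : Vec ℕ (suc ℓ)
    rx ry : ℕ
    r     : Vec ℕ (suc ℓ)
open Struct public

head0 : ∀ {k} → Vec ℕ k → ℕ
head0 []      = 0
head0 (x ∷ _) = x

headV : ∀ {k} → Vec ℕ (suc k) → ℕ
headV (x ∷ _) = x

tailV : ∀ {k} → Vec ℕ (suc k) → Vec ℕ k
tailV (_ ∷ xs) = xs

-- Equations d_i r_i = (sum of r over neighbours) along the path v_0 - v_1 - ... - v_ℓ,
-- where `left` is the sum of the r-values of the neighbours of the first vertex
-- lying before it (for v_0 : r_x + r_y).
PathEqs : ∀ {k} → ℕ → Vec ℕ k → Vec ℕ k → Set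
PathEqs left []       []       = ⊤
PathEqs left (a ∷ ds) (b ∷ rs) = (a * b ≡ left + head0 rs) × PathEqs b ds rs

Equations : ∀ {ℓ} → Struct ℓ → Set
Equations s =
  (dx s * rx s ≡ headV (r s)) ×
  (dy s * ry s ≡ headV (r s)) ×
  PathEqs (rx s + ry s) (d s) (r s)

Positive : ∀ {ℓ} → Struct ℓ → Set
Positive s =
  (0 < dx s) × (0 < dy s) × All (0 <_) (d s) ×
  (0 < rx s) × (0 < ry s) × All (0 <_) (r s)

Primitive : ∀ {ℓ} → Struct ℓ → Set
Primitive s = ∀ k → k ∣ rx s → k ∣ ry s → All (k ∣_) (r s) → k ≡ 1

Arithmetical : ∀ {ℓ} → Struct ℓ → Set
Arithmetical s = Positive s × Equations s × Primitive s

Smooth : ∀ {ℓ} → Struct ℓ → Set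
Smooth s = (2 ≤ dx s) × (2 ≤ dy s) × All (2 ≤_) (tailV (d s))

-- Subdivision at position i = toℕ p + 1 (p : Fin (ℓ+1)), i.e. a new vertex is
-- inserted between path vertices v_p and v_{p+1} (or appended after v_ℓ).
subR : ∀ {ℓ} → Vec ℕ (suc ℓ) → Fin (suc ℓ) → Vec ℕ (suc (suc ℓ))
subR {zero}  (a ∷ [])     zero    = a ∷ a ∷ []
subR {suc ℓ} (a ∷ b ∷ v)  zero    = a ∷ (a + b) ∷ b ∷ v
subR {suc ℓ} (a ∷ v)      (suc p) = a ∷ subR v p

subD : ∀ {ℓ} → Vec ℕ (suc ℓ) → Fin (suc ℓ) → Vec ℕ (suc (suc ℓ))
subD {zero}  (a ∷ [])     zero    = (a + 1) ∷ 1 ∷ []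
subD {suc ℓ} (a ∷ b ∷ v)  zero    = (a + 1) ∷ 1 ∷ (b + 1) ∷ v
subD {suc ℓ} (a ∷ v)      (suc p) = a ∷ subD v p

subdivide : ∀ {ℓ} → Struct ℓ → Fin (suc ℓ) → Struct (suc ℓ)
subdivide s p = mkStruct (dx s) (dy s) (subD (d s) p) (rx s) (ry s) (subR (r s) p)

data Descendant {ℓ : ℕ} (s : Struct ℓ) : ∀ {ℓ'} → Struct ℓ' → Set where
  here : Descendant s s
  step : ∀ {ℓ'} {t : Struct ℓ'} → Descendant s t → (p : Fin (suc ℓ')) →
         Descendant s (subdivide t p)

-- B(j,k) = (j-k+1)/(j+1) * binom(j+k, j)  (exact division for k ≤ j)
B : ℕ → ℕ → ℕ
B j k = ((j ∸ k + 1) * ((j + k) C j)) / suc j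

-- Two subdivisions commute: subdividing at p and then at q + 1, where p < q, gives the same
-- structure as subdividing at q and then at p. Call a sequence of subdivisions canonical if
-- each position is at most one more than the previous one. Commuting every subdivision down
-- past its predecessors turns any sequence into a canonical one, so every descendant of s is
-- reached canonically. Conversely the result of a canonical sequence determines it: the last
-- subdivision inserted the first vertex after v₀ with d = 1 (there is none in the smooth s,
-- and subdivision keeps every d positive), so the last position can be read off, and then the
-- rest. Hence the descendants with k more vertices are listed without repetition by extending
-- every descendant of the previous level at each position up to that vertex, and their number
-- obeys the ballot recursion, which gives C(ℓ+2k, k) − C(ℓ+2k, k−1) = B(k+ℓ, k).

module Submission where

open import Defs
open import Data.Nat using (ℕ; zero; suc; _+_; _*_; _∸_; _≤_; _<_; z≤n; s≤s; _≤′_; ≤′-refl; ≤′-step; _!; _/_)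
open import Data.Nat.Properties
open import Data.Nat.Combinatorics
  using (_C_; nCk≡nC[n∸k]; nCn≡1; nCk+nC[k+1]≡[n+1]C[k+1]; nCk≡n!/k![n-k]!; k![n∸k]!∣n!; [n-k]*d[k+1]≡[k+1]*d[k])
open import Data.Nat.DivMod using (m*n/n≡m; m/n*n≡m)
open import Data.Nat.ListAction using (sum)
open import Data.Nat.ListAction.Properties using (sum-++)
open import Data.Nat.Tactic.RingSolver using (solve-∀)
open import Algebra.Properties.CommutativeSemigroup +-commutativeSemigroup using (xy∙z≈x∙zy; xy∙z≈xz∙y; interchange)
import Algebra.Properties.CommutativeSemigroup *-commutativeSemigroup as *-Comm
open import Data.Fin using (Fin; zero; suc; toℕ; inject₁)
open import Data.Fin.Properties using (toℕ-injective; toℕ-inject₁; toℕ≤pred[n])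
open import Data.Vec using (Vec; []; _∷_)
open import Data.Vec.Properties using (∷-injective; ∷-injectiveˡ; ∷-injectiveʳ)
open import Data.Vec.Relation.Unary.All using (All; []; _∷_)
import Data.Vec.Relation.Unary.All as All
open import Data.List using (List; []; _∷_; _++_; _∷ʳ_; map; concatMap; length; upTo; applyUpTo)
open import Data.List.Properties using (map-++; map-∘; map-upTo; map-cong-local; applyUpTo-∷ʳ)
open import Data.List.Membership.Propositional using (_∈_; find; lose)
open import Data.List.Membership.Propositional.Properties
  using (∈-map⁺; ∈-map⁻; ∈-concatMap⁺; ∈-concatMap⁻; ∈-upTo⁺; ∈-upTo⁻)
open import Data.List.Relation.Unary.Any using (here; there)
import Data.List.Relation.Unary.All as ListAll
open import Data.List.Relation.Unary.AllPairs using ([]; _∷_)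
open import Data.List.Relation.Unary.Unique.Propositional using (Unique)
open import Data.List.Relation.Unary.Unique.Propositional.Properties using (++⁺; map⁺; map⁻; upTo⁺)
open import Data.Product using (Σ; ∃-syntax; -,_; _×_; _,_; proj₂)
open import Data.Sum using (_⊎_; inj₁; inj₂)
open import Data.Unit using (tt)
open import Function using (_∘_)
open import Function.Bundles using (_⇔_; mk⇔; Equivalence)
open import Relation.Nullary using (contradiction; yes; no)
open import Relation.Binary.PropositionalEquality

incHead : ∀ {n} → Vec ℕ (suc n) → Vec ℕ (suc n)
incHead (a ∷ v) = (a + 1) ∷ v

incHead-subD : ∀ {ℓ} (v : Vec ℕ (suc ℓ)) q → incHead (subD v q) ≡ subD (incHead v) q
incHead-subD {zero}  (a ∷ [])    zero    = refl
incHead-subD {suc ℓ} (a ∷ b ∷ w) zero    = refl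
incHead-subD {suc ℓ} (a ∷ b ∷ w) (suc q) = refl

headV-subR : ∀ {ℓ} (v : Vec ℕ (suc ℓ)) q → headV (subR v q) ≡ headV v
headV-subR {zero}  (a ∷ [])    zero    = refl
headV-subR {suc ℓ} (a ∷ b ∷ w) zero    = refl
headV-subR {suc ℓ} (a ∷ b ∷ w) (suc q) = refl

subD-cons-zero : ∀ {n} a (v : Vec ℕ (suc (suc n))) → subD (a ∷ v) zero ≡ (a + 1) ∷ 1 ∷ incHead v
subD-cons-zero a (b ∷ w) = refl

subR-cons-zero : ∀ {n} a (v : Vec ℕ (suc (suc n))) → subR (a ∷ v) zero ≡ a ∷ (a + headV v) ∷ v
subR-cons-zero a (b ∷ w) = refl

subD-cons-suc : ∀ {n} a (v : Vec ℕ (suc (suc n))) p → subD (a ∷ v) (suc p) ≡ a ∷ subD v p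
subD-cons-suc a (b ∷ w) p = refl

subR-cons-suc : ∀ {n} a (v : Vec ℕ (suc (suc n))) p → subR (a ∷ v) (suc p) ≡ a ∷ subR v p
subR-cons-suc a (b ∷ w) p = refl

subD-comm : ∀ {ℓ} (v : Vec ℕ (suc ℓ)) (p q : Fin (suc ℓ)) → toℕ p < toℕ q →
            subD (subD v p) (suc q) ≡ subD (subD v q) (inject₁ p)
subD-comm {suc ℓ} (a ∷ b ∷ w) zero (suc q) _ = begin
  (a + 1) ∷ 1 ∷ subD (incHead (b ∷ w)) q   ≡⟨ cong (λ x → (a + 1) ∷ 1 ∷ x) (incHead-subD (b ∷ w) q) ⟨
  (a + 1) ∷ 1 ∷ incHead (subD (b ∷ w) q)   ≡⟨ subD-cons-zero a (subD (b ∷ w) q) ⟨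
  subD (a ∷ subD (b ∷ w) q) zero           ∎
  where open ≡-Reasoning
subD-comm {suc ℓ} (a ∷ b ∷ w) (suc p) (suc q) (s≤s p<q) = begin
  subD (a ∷ subD (b ∷ w) p) (suc (suc q))  ≡⟨ subD-cons-suc a (subD (b ∷ w) p) (suc q) ⟩
  a ∷ subD (subD (b ∷ w) p) (suc q)        ≡⟨ cong (a ∷_) (subD-comm (b ∷ w) p q p<q) ⟩
  a ∷ subD (subD (b ∷ w) q) (inject₁ p)    ≡⟨ subD-cons-suc a (subD (b ∷ w) q) (inject₁ p) ⟨
  subD (a ∷ subD (b ∷ w) q) (suc (inject₁ p)) ∎
  where open ≡-Reasoning

subR-comm : ∀ {ℓ} (v : Vec ℕ (suc ℓ)) (p q : Fin (suc ℓ)) → toℕ p < toℕ q →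
            subR (subR v p) (suc q) ≡ subR (subR v q) (inject₁ p)
subR-comm {suc ℓ} (a ∷ b ∷ w) zero (suc q) _ = begin
  a ∷ (a + b) ∷ subR (b ∷ w) q                    ≡⟨ cong (λ x → a ∷ (a + x) ∷ subR (b ∷ w) q) (headV-subR (b ∷ w) q) ⟨
  a ∷ (a + headV (subR (b ∷ w) q)) ∷ subR (b ∷ w) q ≡⟨ subR-cons-zero a (subR (b ∷ w) q) ⟨
  subR (a ∷ subR (b ∷ w) q) zero                  ∎
  where open ≡-Reasoning
subR-comm {suc ℓ} (a ∷ b ∷ w) (suc p) (suc q) (s≤s p<q) = begin
  subR (a ∷ subR (b ∷ w) p) (suc (suc q))  ≡⟨ subR-cons-suc a (subR (b ∷ w) p) (suc q) ⟩
  a ∷ subR (subR (b ∷ w) p) (suc q)        ≡⟨ cong (a ∷_) (subR-comm (b ∷ w) p q p<q) ⟩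
  a ∷ subR (subR (b ∷ w) q) (inject₁ p)    ≡⟨ subR-cons-suc a (subR (b ∷ w) q) (inject₁ p) ⟨
  subR (a ∷ subR (b ∷ w) q) (suc (inject₁ p)) ∎
  where open ≡-Reasoning

subdivide-comm : ∀ {ℓ} (t : Struct ℓ) (p q : Fin (suc ℓ)) → toℕ p < toℕ q →
                 subdivide (subdivide t p) (suc q) ≡ subdivide (subdivide t q) (inject₁ p)
subdivide-comm t p q p<q =
  cong₂ (λ dv rv → mkStruct (dx t) (dy t) dv (rx t) (ry t) rv) (subD-comm (d t) p q p<q) (subR-comm (r t) p q p<q)

+1-injective : ∀ {a b} → a + 1 ≡ b + 1 → a ≡ b
+1-injective {a} {b} = +-cancelʳ-≡ 1 a b

subD-injectiveˡ : ∀ {ℓ} (v w : Vec ℕ (suc ℓ)) p → subD v p ≡ subD w p → v ≡ w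
subD-injectiveˡ {zero}  (a ∷ [])    (a′ ∷ [])     zero eq = cong (_∷ []) (+1-injective (∷-injectiveˡ eq))
subD-injectiveˡ {suc ℓ} (a ∷ b ∷ v) (a′ ∷ b′ ∷ w) zero eq
  with a≡a′ , eq′ ← ∷-injective eq
  with b≡b′ , v≡w ← ∷-injective (∷-injectiveʳ eq′)
  = cong₂ _∷_ (+1-injective a≡a′) (cong₂ _∷_ (+1-injective b≡b′) v≡w)
subD-injectiveˡ {suc ℓ} (a ∷ b ∷ v) (a′ ∷ b′ ∷ w) (suc p) eq
  with a≡a′ , eq′ ← ∷-injective eq
  = cong₂ _∷_ a≡a′ (subD-injectiveˡ (b ∷ v) (b′ ∷ w) p eq′)

subR-injectiveˡ : ∀ {ℓ} (v w : Vec ℕ (suc ℓ)) p → subR v p ≡ subR w p → v ≡ w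
subR-injectiveˡ {zero}  (a ∷ [])    (a′ ∷ [])     zero eq = cong (_∷ []) (∷-injectiveˡ eq)
subR-injectiveˡ {suc ℓ} (a ∷ b ∷ v) (a′ ∷ b′ ∷ w) zero eq =
  cong₂ _∷_ (∷-injectiveˡ eq) (∷-injectiveʳ (∷-injectiveʳ eq))
subR-injectiveˡ {suc ℓ} (a ∷ b ∷ v) (a′ ∷ b′ ∷ w) (suc p) eq
  with a≡a′ , eq′ ← ∷-injective eq
  = cong₂ _∷_ a≡a′ (subR-injectiveˡ (b ∷ v) (b′ ∷ w) p eq′)

subD-injectiveʳ : ∀ {ℓ} (v : Vec ℕ (suc ℓ)) p q → subD v p ≡ subD v q → p ≡ q
subD-injectiveʳ {zero}  (a ∷ [])    zero    zero    _  = refl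
subD-injectiveʳ {suc ℓ} (a ∷ b ∷ w) zero    zero    _  = refl
subD-injectiveʳ {suc ℓ} (a ∷ b ∷ w) zero    (suc q) eq = contradiction (∷-injectiveˡ eq) (m+1+n≢m a)
subD-injectiveʳ {suc ℓ} (a ∷ b ∷ w) (suc p) zero    eq = contradiction (sym (∷-injectiveˡ eq)) (m+1+n≢m a)
subD-injectiveʳ {suc ℓ} (a ∷ b ∷ w) (suc p) (suc q) eq = cong suc (subD-injectiveʳ (b ∷ w) p q (∷-injectiveʳ eq))

subdivide-injectiveˡ : ∀ {ℓ} (t u : Struct ℓ) p → subdivide t p ≡ subdivide u p → t ≡ u
subdivide-injectiveˡ (mkStruct _ _ dv _ _ rv) (mkStruct _ _ dv′ _ _ rv′) p eq
  with refl ← cong dx eq | refl ← cong dy eq | refl ← cong rx eq | refl ← cong ry eq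
  with refl ← subD-injectiveˡ dv dv′ p (cong d eq) | refl ← subR-injectiveˡ rv rv′ p (cong r eq)
  = refl

subdivide-injectiveʳ : ∀ {ℓ} (t : Struct ℓ) p q → subdivide t p ≡ subdivide t q → p ≡ q
subdivide-injectiveʳ t p q eq = subD-injectiveʳ (d t) p q (cong d eq)

head0≡headV : ∀ {n} (v : Vec ℕ (suc n)) → head0 v ≡ headV v
head0≡headV (a ∷ v) = refl

*-distribʳ-+1 : ∀ a {b c} → a * b ≡ c → (a + 1) * b ≡ c + b
*-distribʳ-+1 a {b} ab≡c = trans (*-distribʳ-+ b a 1) (cong₂ _+_ ab≡c (*-identityˡ b))

PathEqs-subdivide : ∀ {ℓ} left (dv rv : Vec ℕ (suc ℓ)) p →
                    PathEqs left dv rv → PathEqs left (subD dv p) (subR rv p)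
PathEqs-subdivide {zero} left (a ∷ []) (b ∷ []) zero (eq , tt) =
  trans (*-distribʳ-+1 a eq) (cong (_+ b) (+-identityʳ left)) , refl , tt
PathEqs-subdivide {suc ℓ} left (a ∷ a′ ∷ dv) (b ∷ b′ ∷ rv) zero (eq , eq′ , eqs) =
  trans (*-distribʳ-+1 a eq) (xy∙z≈x∙zy left b′ b) ,
  +-identityʳ (b + b′) ,
  trans (*-distribʳ-+1 a′ eq′) (xy∙z≈xz∙y b (head0 rv) b′) ,
  eqs
PathEqs-subdivide {suc ℓ} left (a ∷ a′ ∷ dv) (b ∷ b′ ∷ rv) (suc p) (eq , eqs) =
  trans eq (cong (left +_) (sym (trans (head0≡headV (subR (b′ ∷ rv) p)) (headV-subR (b′ ∷ rv) p)))) ,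
  PathEqs-subdivide b (a′ ∷ dv) (b′ ∷ rv) p eqs

0<+1 : ∀ a → 0 < a + 1
0<+1 a = m≤n+m 1 a

subD-positive : ∀ {ℓ} (v : Vec ℕ (suc ℓ)) p → All (0 <_) v → All (0 <_) (subD v p)
subD-positive {zero}  (a ∷ [])    zero    (_ ∷ [])       = 0<+1 a ∷ s≤s z≤n ∷ []
subD-positive {suc ℓ} (a ∷ b ∷ w) zero    (_ ∷ _ ∷ pos)  = 0<+1 a ∷ s≤s z≤n ∷ 0<+1 b ∷ pos
subD-positive {suc ℓ} (a ∷ b ∷ w) (suc p) (0<a ∷ pos)    = 0<a ∷ subD-positive (b ∷ w) p pos

subD-tail-positive : ∀ {ℓ} (v : Vec ℕ (suc ℓ)) p → All (0 <_) (tailV v) → All (0 <_) (tailV (subD v p))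
subD-tail-positive {zero}  (a ∷ [])    zero    []           = s≤s z≤n ∷ []
subD-tail-positive {suc ℓ} (a ∷ b ∷ w) zero    (_ ∷ pos)    = s≤s z≤n ∷ 0<+1 b ∷ pos
subD-tail-positive {suc ℓ} (a ∷ b ∷ w) (suc p) pos          = subD-positive (b ∷ w) p pos

subR-positive : ∀ {ℓ} (v : Vec ℕ (suc ℓ)) p → All (0 <_) v → All (0 <_) (subR v p)
subR-positive {zero}  (a ∷ [])    zero    (0<a ∷ [])        = 0<a ∷ 0<a ∷ []
subR-positive {suc ℓ} (a ∷ b ∷ w) zero    (0<a ∷ 0<b ∷ pos) = 0<a ∷ ≤-trans 0<a (m≤m+n a b) ∷ 0<b ∷ pos
subR-positive {suc ℓ} (a ∷ b ∷ w) (suc p) (0<a ∷ pos)       = 0<a ∷ subR-positive (b ∷ w) p pos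

All-subR⁻ : ∀ {ℓ} {P : ℕ → Set} (v : Vec ℕ (suc ℓ)) p → All P (subR v p) → All P v
All-subR⁻ {zero}  (a ∷ [])    zero    (pa ∷ _)      = pa ∷ []
All-subR⁻ {suc ℓ} (a ∷ b ∷ w) zero    (pa ∷ _ ∷ pw) = pa ∷ pw
All-subR⁻ {suc ℓ} (a ∷ b ∷ w) (suc p) (pa ∷ pw)     = pa ∷ All-subR⁻ (b ∷ w) p pw

subdivide-arithmetical : ∀ {ℓ} (t : Struct ℓ) p → Arithmetical t → Arithmetical (subdivide t p)
subdivide-arithmetical t p ((0<dx , 0<dy , 0<d , 0<rx , 0<ry , 0<r) , (eqx , eqy , eqs) , prim) =
  (0<dx , 0<dy , subD-positive (d t) p 0<d , 0<rx , 0<ry , subR-positive (r t) p 0<r) ,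
  (trans eqx (sym (headV-subR (r t) p)) , trans eqy (sym (headV-subR (r t) p)) ,
   PathEqs-subdivide (rx t + ry t) (d t) (r t) p eqs) ,
  λ k k∣rx k∣ry k∣r → prim k k∣rx k∣ry (All-subR⁻ (r t) p k∣r)

firstOne : ∀ {n} → Vec ℕ n → ℕ
firstOne []                = 0
firstOne (zero          ∷ v) = suc (firstOne v)
firstOne (suc zero      ∷ v) = 1
firstOne (suc (suc _)   ∷ v) = suc (firstOne v)

firstOne-∷ : ∀ {n} {x} (v : Vec ℕ n) → x ≢ 1 → firstOne (x ∷ v) ≡ suc (firstOne v)
firstOne-∷ {x = zero}        v _   = refl
firstOne-∷ {x = suc zero}    v x≢1 = contradiction refl x≢1
firstOne-∷ {x = suc (suc _)} v _   = refl

firstOne-≥2 : ∀ {n} {v : Vec ℕ n} → All (2 ≤_) v → firstOne v ≡ n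
firstOne-≥2 []             = refl
firstOne-≥2 (2≤x ∷ 2≤v) = trans (firstOne-∷ _ (λ { refl → 1+n≰n 2≤x })) (cong suc (firstOne-≥2 2≤v))

+1≢1 : ∀ {a} → 0 < a → a + 1 ≢ 1
+1≢1 0<a a+1≡1 = <⇒≢ 0<a (sym (+1-injective a+1≡1))

firstOne-subD : ∀ {ℓ} (v : Vec ℕ (suc ℓ)) q → All (0 <_) v → toℕ q < firstOne v →
                firstOne (subD v q) ≡ suc (suc (toℕ q))
firstOne-subD {zero}  (a ∷ [])              zero    (0<a ∷ _) _ = firstOne-∷ (1 ∷ []) (+1≢1 0<a)
firstOne-subD {suc ℓ} (a ∷ b ∷ w)           zero    (0<a ∷ _) _ = firstOne-∷ (1 ∷ (b + 1) ∷ w) (+1≢1 0<a)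
firstOne-subD {suc ℓ} (zero ∷ b ∷ w)        (suc q) (() ∷ _) _
firstOne-subD {suc ℓ} (suc zero ∷ b ∷ w)    (suc q) _ (s≤s ())
firstOne-subD {suc ℓ} (suc (suc a) ∷ b ∷ w) (suc q) (_ ∷ pos) (s≤s q<) =
  cong suc (firstOne-subD (b ∷ w) q pos q<)

-- The index i ≥ 1 of the first path vertex v_i with d_i = 1, or ℓ if there is none.
pivot : ∀ {ℓ} → Struct ℓ → ℕ
pivot t = firstOne (tailV (d t))

pivot-subdivide : ∀ {ℓ} (t : Struct ℓ) p → All (0 <_) (tailV (d t)) → toℕ p ≤ pivot t →
                  pivot (subdivide t p) ≡ suc (toℕ p)
pivot-subdivide t p = go (d t) p
  where
  go : ∀ {ℓ} (v : Vec ℕ (suc ℓ)) p → All (0 <_) (tailV v) → toℕ p ≤ firstOne (tailV v) →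
       firstOne (tailV (subD v p)) ≡ suc (toℕ p)
  go {zero}  (a ∷ [])    zero    _   _       = refl
  go {suc ℓ} (a ∷ b ∷ w) zero    _   _       = refl
  go {suc ℓ} (a ∷ b ∷ w) (suc p) pos p<first = firstOne-subD (b ∷ w) p pos p<first

Descendant-arithmetical : ∀ {ℓ ℓ′} {s : Struct ℓ} {t : Struct ℓ′} →
                          Arithmetical s → Descendant s t → Arithmetical t
Descendant-arithmetical arith here         = arith
Descendant-arithmetical arith (step dst p) = subdivide-arithmetical _ p (Descendant-arithmetical arith dst)

Descendant-tail-positive : ∀ {ℓ ℓ′} {s : Struct ℓ} {t : Struct ℓ′} →
                           All (0 <_) (tailV (d s)) → Descendant s t → All (0 <_) (tailV (d t))
Descendant-tail-positive pos here         = pos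
Descendant-tail-positive pos (step dst p) = subD-tail-positive _ p (Descendant-tail-positive pos dst)

Descendant-≤ : ∀ {ℓ ℓ′} {s : Struct ℓ} {t : Struct ℓ′} → Descendant s t → ℓ ≤ ℓ′
Descendant-≤ here         = ≤-refl
Descendant-≤ (step dst p) = m≤n⇒m≤1+n (Descendant-≤ dst)

positionsUpTo : (K m : ℕ) → List (Fin (suc K))
positionsUpTo K       zero    = zero ∷ []
positionsUpTo zero    (suc m) = zero ∷ []
positionsUpTo (suc K) (suc m) = zero ∷ map suc (positionsUpTo K m)

map-toℕ-positionsUpTo : ∀ {K m} → m ≤ K → map toℕ (positionsUpTo K m) ≡ upTo (suc m)
map-toℕ-positionsUpTo {K}     {zero}  _         = refl
map-toℕ-positionsUpTo {suc K} {suc m} (s≤s m≤K) = cong (0 ∷_) (begin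
  map toℕ (map suc ps)     ≡⟨ map-∘ ps ⟨
  map (suc ∘ toℕ) ps       ≡⟨ map-∘ ps ⟩
  map suc (map toℕ ps)     ≡⟨ cong (map suc) (map-toℕ-positionsUpTo m≤K) ⟩
  map suc (upTo (suc m))   ≡⟨ map-upTo suc (suc m) ⟩
  applyUpTo suc (suc m)    ∎)
  where
  open ≡-Reasoning
  ps : List (Fin (suc K))
  ps = positionsUpTo K m

module _ {K m : ℕ} (m≤K : m ≤ K) where

  ∈-positionsUpTo⁺ : ∀ {p} → toℕ p ≤ m → p ∈ positionsUpTo K m
  ∈-positionsUpTo⁺ p≤m
    with q , q∈ , p≡q ← ∈-map⁻ toℕ (subst (_ ∈_) (sym (map-toℕ-positionsUpTo m≤K)) (∈-upTo⁺ (s≤s p≤m)))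
    = subst (_∈ _) (sym (toℕ-injective p≡q)) q∈

  ∈-positionsUpTo⁻ : ∀ {p} → p ∈ positionsUpTo K m → toℕ p ≤ m
  ∈-positionsUpTo⁻ p∈ = ≤-pred (∈-upTo⁻ (subst (_ ∈_) (map-toℕ-positionsUpTo m≤K) (∈-map⁺ toℕ p∈)))

  positionsUpTo-unique : Unique (positionsUpTo K m)
  positionsUpTo-unique = map⁻ (subst Unique (sym (map-toℕ-positionsUpTo m≤K)) (upTo⁺ (suc m)))

  sum-positionsUpTo : ∀ f → sum (map (f ∘ toℕ) (positionsUpTo K m)) ≡ sum (applyUpTo f (suc m))
  sum-positionsUpTo f = cong sum (begin
    map (f ∘ toℕ) (positionsUpTo K m)   ≡⟨ map-∘ _ ⟩
    map f (map toℕ (positionsUpTo K m)) ≡⟨ cong (map f) (map-toℕ-positionsUpTo m≤K) ⟩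
    map f (upTo (suc m))                ≡⟨ map-upTo f (suc m) ⟩
    applyUpTo f (suc m)                 ∎)
    where open ≡-Reasoning

module _ {A B : Set} (f : A → List B) where

  concatMap-unique : ∀ {xs} → Unique xs → (∀ {x} → x ∈ xs → Unique (f x)) →
                     (∀ {x y z} → x ∈ xs → y ∈ xs → z ∈ f x → z ∈ f y → x ≡ y) →
                     Unique (concatMap f xs)
  concatMap-unique {[]}     _            _        _        = []
  concatMap-unique {x ∷ xs} (x∉xs ∷ uxs) unique-f disjoint =
    ++⁺ (unique-f (here refl))
        (concatMap-unique uxs (unique-f ∘ there) (λ x∈ y∈ → disjoint (there x∈) (there y∈)))
        λ (z∈fx , z∈rest) →
          let y , y∈xs , z∈fy = find (∈-concatMap⁻ f z∈rest)
          in ListAll.lookup x∉xs y∈xs (disjoint (here refl) (there y∈xs) z∈fx z∈fy)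

  sum-map-concatMap : ∀ (g : B → ℕ) xs → sum (map g (concatMap f xs)) ≡ sum (map (sum ∘ map g ∘ f) xs)
  sum-map-concatMap g []       = refl
  sum-map-concatMap g (x ∷ xs) = begin
    sum (map g (f x ++ concatMap f xs))               ≡⟨ cong sum (map-++ g (f x) _) ⟩
    sum (map g (f x) ++ map g (concatMap f xs))       ≡⟨ sum-++ (map g (f x)) _ ⟩
    sum (map g (f x)) + sum (map g (concatMap f xs))  ≡⟨ cong (sum (map g (f x)) +_) (sum-map-concatMap g xs) ⟩
    sum (map g (f x)) + sum (map (sum ∘ map g ∘ f) xs) ∎
    where open ≡-Reasoning

sum-map-1≡length : ∀ {A : Set} (xs : List A) → sum (map (λ _ → 1) xs) ≡ length xs
sum-map-1≡length []       = refl
sum-map-1≡length (x ∷ xs) = cong suc (sum-map-1≡length xs)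

-- The number of canonical continuations of length k when the next position is at most m.
ballot : ℕ → ℕ → ℕ
ballot zero    m = 1
ballot (suc k) m = sum (applyUpTo (λ i → ballot k (suc i)) (suc m))

module Descendants {ℓ} (s : Struct ℓ) (smooth : All (2 ≤_) (tailV (d s))) where

  data Canonical : ∀ {ℓ′} → Struct ℓ′ → ℕ → Set where
    base : Canonical s ℓ
    ext  : ∀ {ℓ′} {t : Struct ℓ′} {m} → Canonical t m →
           (p : Fin (suc ℓ′)) → toℕ p ≤ m → Canonical (subdivide t p) (suc (toℕ p))

  canonical⇒descendant : ∀ {ℓ′} {t : Struct ℓ′} {m} → Canonical t m → Descendant s t
  canonical⇒descendant base        = here
  canonical⇒descendant (ext c p _) = step (canonical⇒descendant c) p

  canonical-subdivide : ∀ {ℓ′} {t : Struct ℓ′} {m} → Canonical t m → (q : Fin (suc ℓ′)) →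
                        ∃[ m′ ] Canonical (subdivide t q) m′ × (m′ ≡ suc (toℕ q) ⊎ m′ ≡ m)
  canonical-subdivide base q = -, ext base q (toℕ≤pred[n] q) , inj₁ refl
  canonical-subdivide (ext c p p≤m) q with toℕ q ≤? suc (toℕ p)
  ... | yes q≤ = -, ext (ext c p p≤m) q q≤ , inj₁ refl
  canonical-subdivide (ext c p p≤m) zero    | no q≰ = contradiction z≤n q≰
  -- A subdivision beyond the bound is commuted below the last one.
  canonical-subdivide (ext {t = u} {m} c p p≤m) (suc q) | no q≰
    with m′ , c′ , m′-cases ← canonical-subdivide c q =
    -, subst₂ Canonical (sym (subdivide-comm u p q p<q)) (cong suc (toℕ-inject₁ p))
                        (ext c′ (inject₁ p) (subst (_≤ m′) (sym (toℕ-inject₁ p)) (p≤m′ m′-cases))) ,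
    inj₂ refl
    where
    p<q : toℕ p < toℕ q
    p<q = ≤-pred (≰⇒> q≰)
    p≤m′ : ∀ {m′} → m′ ≡ suc (toℕ q) ⊎ m′ ≡ m → toℕ p ≤ m′
    p≤m′ (inj₁ refl) = m≤n⇒m≤1+n (<⇒≤ p<q)
    p≤m′ (inj₂ refl) = p≤m

  descendant⇒canonical : ∀ {ℓ′} {t : Struct ℓ′} → Descendant s t → ∃[ m ] Canonical t m
  descendant⇒canonical here         = ℓ , base
  descendant⇒canonical (step dst p) =
    let _ , c      = descendant⇒canonical dst
        _ , c′ , _ = canonical-subdivide c p
    in -, c′

  canonical-tail-positive : ∀ {ℓ′} {t : Struct ℓ′} {m} → Canonical t m → All (0 <_) (tailV (d t))
  canonical-tail-positive c = Descendant-tail-positive (All.map (≤-trans (s≤s z≤n)) smooth) (canonical⇒descendant c)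

  canonical-pivot : ∀ {ℓ′} {t : Struct ℓ′} {m} → Canonical t m → pivot t ≡ m
  canonical-pivot base                      = firstOne-≥2 smooth
  canonical-pivot (ext {t = u} c p p≤m) =
    pivot-subdivide u p (canonical-tail-positive c) (subst (toℕ p ≤_) (sym (canonical-pivot c)) p≤m)

  canonical-bound : ∀ {ℓ′} {t : Struct ℓ′} {m} → Canonical t m → m ≤ ℓ′
  canonical-bound base        = ≤-refl
  canonical-bound (ext c p _) = s≤s (toℕ≤pred[n] p)

  children : ∀ {ℓ′} → Struct ℓ′ → List (Struct (suc ℓ′))
  children {ℓ′} u = map (subdivide u) (positionsUpTo ℓ′ (pivot u))

  level : ∀ {ℓ′} → ℓ ≤′ ℓ′ → List (Struct ℓ′)
  level ≤′-refl      = s ∷ []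
  level (≤′-step ℓ≤) = concatMap children (level ℓ≤)

  canonical-at-pivot : ∀ {ℓ′} {t : Struct ℓ′} {m} → Canonical t m → Canonical t (pivot t)
  canonical-at-pivot c with refl ← canonical-pivot c = c

  level-canonical : ∀ {ℓ′} (ℓ≤ : ℓ ≤′ ℓ′) {t} → t ∈ level ℓ≤ → Canonical t (pivot t)
  level-canonical ≤′-refl (here refl) = canonical-at-pivot base
  level-canonical (≤′-step ℓ≤) t∈
    with u , u∈ , t∈children ← find (∈-concatMap⁻ children t∈)
    with p , p∈ , refl ← ∈-map⁻ (subdivide u) t∈children
    with c ← level-canonical ℓ≤ u∈
    = canonical-at-pivot (ext c p (∈-positionsUpTo⁻ (canonical-bound c) p∈))

  level-complete : ∀ {ℓ′} {t : Struct ℓ′} {m} → Canonical t m → (ℓ≤ : ℓ ≤′ ℓ′) → t ∈ level ℓ≤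
  level-complete base ≤′-refl        = here refl
  level-complete base (≤′-step ℓ≤)   = contradiction (≤′⇒≤ ℓ≤) 1+n≰n
  level-complete (ext c p _) ≤′-refl = contradiction (Descendant-≤ (canonical⇒descendant c)) 1+n≰n
  level-complete (ext {t = u} c p p≤m) (≤′-step ℓ≤) with refl ← canonical-pivot c =
    ∈-concatMap⁺ children (lose (level-complete c ℓ≤)
      (∈-map⁺ (subdivide u) (∈-positionsUpTo⁺ (canonical-bound c) p≤m)))

  ∈-level⇔descendant : ∀ {ℓ′} (ℓ≤ : ℓ ≤′ ℓ′) {t} → t ∈ level ℓ≤ ⇔ Descendant s t
  ∈-level⇔descendant ℓ≤ = mk⇔ (canonical⇒descendant ∘ level-canonical ℓ≤)
                              (λ dst → level-complete (proj₂ (descendant⇒canonical dst)) ℓ≤)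

  module _ {ℓ′} (ℓ≤ : ℓ ≤′ ℓ′) {u} (u∈ : u ∈ level ℓ≤) where

    pivot-level≤ : pivot u ≤ ℓ′
    pivot-level≤ = canonical-bound (level-canonical ℓ≤ u∈)

    pivot-child : ∀ {p} → p ∈ positionsUpTo ℓ′ (pivot u) → pivot (subdivide u p) ≡ suc (toℕ p)
    pivot-child {p} p∈ = pivot-subdivide u p (canonical-tail-positive (level-canonical ℓ≤ u∈))
                                            (∈-positionsUpTo⁻ pivot-level≤ p∈)

    children-unique : Unique (children u)
    children-unique = map⁺ (subdivide-injectiveʳ u _ _) (positionsUpTo-unique pivot-level≤)

    sum-children : ∀ j → sum (map (ballot j ∘ pivot) (children u)) ≡ ballot (suc j) (pivot u)
    sum-children j = begin
      sum (map (ballot j ∘ pivot) (map (subdivide u) ps)) ≡⟨ cong sum (map-∘ ps) ⟨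
      sum (map (ballot j ∘ pivot ∘ subdivide u) ps)      ≡⟨ cong sum (map-cong-local (ListAll.tabulate (cong (ballot j) ∘ pivot-child))) ⟩
      sum (map (ballot j ∘ suc ∘ toℕ) ps)                ≡⟨ sum-positionsUpTo pivot-level≤ (ballot j ∘ suc) ⟩
      ballot (suc j) (pivot u)                           ∎
      where
      open ≡-Reasoning
      ps : List (Fin (suc ℓ′))
      ps = positionsUpTo ℓ′ (pivot u)

  level-unique : ∀ {ℓ′} (ℓ≤ : ℓ ≤′ ℓ′) → Unique (level ℓ≤)
  level-unique ≤′-refl      = ListAll.[] ∷ []
  level-unique (≤′-step ℓ≤) = concatMap-unique children (level-unique ℓ≤) (children-unique ℓ≤) disjoint
    where
    disjoint : ∀ {x y z} → x ∈ level ℓ≤ → y ∈ level ℓ≤ → z ∈ children x → z ∈ children y → x ≡ y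
    disjoint {x} {y} x∈ y∈ z∈x z∈y
      with p , p∈ , refl ← ∈-map⁻ (subdivide x) z∈x
      with q , q∈ , eq ← ∈-map⁻ (subdivide y) z∈y
      with refl ← toℕ-injective (suc-injective
                    (trans (sym (pivot-child ℓ≤ x∈ p∈)) (trans (cong pivot eq) (pivot-child ℓ≤ y∈ q∈))))
      = subdivide-injectiveˡ x y p eq

  sum-level : ∀ {ℓ′} (ℓ≤ : ℓ ≤′ ℓ′) j → sum (map (ballot j ∘ pivot) (level ℓ≤)) ≡ ballot (ℓ′ ∸ ℓ + j) ℓ
  sum-level ≤′-refl j = trans (+-identityʳ _) (cong₂ ballot (cong (_+ j) (sym (n∸n≡0 ℓ))) (canonical-pivot base))
  sum-level {suc ℓ′} (≤′-step ℓ≤) j = begin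
    sum (map (ballot j ∘ pivot) (concatMap children (level ℓ≤)))   ≡⟨ sum-map-concatMap children _ (level ℓ≤) ⟩
    sum (map (sum ∘ map (ballot j ∘ pivot) ∘ children) (level ℓ≤)) ≡⟨ cong sum (map-cong-local (ListAll.tabulate λ u∈ → sum-children ℓ≤ u∈ j)) ⟩
    sum (map (ballot (suc j) ∘ pivot) (level ℓ≤))                  ≡⟨ sum-level ℓ≤ (suc j) ⟩
    ballot (ℓ′ ∸ ℓ + suc j) ℓ                                      ≡⟨ cong (λ k → ballot k ℓ) (+-suc (ℓ′ ∸ ℓ) j) ⟩
    ballot (suc (ℓ′ ∸ ℓ) + j) ℓ                                    ≡⟨ cong (λ k → ballot (k + j) ℓ) (+-∸-assoc 1 (≤′⇒≤ ℓ≤)) ⟨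
    ballot (suc ℓ′ ∸ ℓ + j) ℓ                                      ∎
    where open ≡-Reasoning

  level-length : ∀ {ℓ′} (ℓ≤ : ℓ ≤′ ℓ′) → length (level ℓ≤) ≡ ballot (ℓ′ ∸ ℓ) ℓ
  level-length {ℓ′} ℓ≤ = begin
    length (level ℓ≤)                      ≡⟨ sum-map-1≡length (level ℓ≤) ⟨
    sum (map (ballot 0 ∘ pivot) (level ℓ≤)) ≡⟨ sum-level ℓ≤ 0 ⟩
    ballot (ℓ′ ∸ ℓ + 0) ℓ                  ≡⟨ cong (λ k → ballot k ℓ) (+-identityʳ (ℓ′ ∸ ℓ)) ⟩
    ballot (ℓ′ ∸ ℓ) ℓ                      ∎
    where open ≡-Reasoning

nC0≡1 : ∀ n → n C 0 ≡ 1
nC0≡1 n = trans (nCk≡nC[n∸k] {0} {n} z≤n) (nCn≡1 n)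

-- C(n, k − 1), with the convention C(n, −1) = 0.
infixl 6.5 _C⁻_

_C⁻_ : ℕ → ℕ → ℕ
n C⁻ zero  = 0
n C⁻ suc k = n C k

pascal : ∀ n k → suc n C k ≡ n C⁻ k + n C k
pascal n zero    = trans (nC0≡1 (suc n)) (sym (nC0≡1 n))
pascal n (suc k) = sym (nCk+nC[k+1]≡[n+1]C[k+1] n k)

C-middle : ∀ k → suc (k + k) C suc k ≡ suc (k + k) C k
C-middle k = trans (nCk≡nC[n∸k] (s≤s (m≤m+n k k))) (cong (suc (k + k) C_) (m+n∸m≡n k k))

nCk*k![n∸k]!≡n! : ∀ {n k} → k ≤ n → (n C k) * (k ! * (n ∸ k) !) ≡ n !
nCk*k![n∸k]!≡n! {n} {k} k≤n =
  trans (cong (_* (k ! * (n ∸ k) !)) (nCk≡n!/k![n-k]! k≤n)) (m/n*n≡m (k![n∸k]!∣n! k≤n))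
  where instance _ = k !* (n ∸ k) !≢0

C-absorb : ∀ {n k} → k < n → (n C k) * (n ∸ k) ≡ (n C suc k) * suc k
C-absorb {n} {k} k<n = *-cancelʳ-≡ _ _ (k ! * (n ∸ k) !) {{k !* (n ∸ k) !≢0}} (begin
  (n C k) * (n ∸ k) * (k ! * (n ∸ k) !)               ≡⟨ *-Comm.xy∙z≈y∙xz (n C k) (n ∸ k) _ ⟩
  (n ∸ k) * ((n C k) * (k ! * (n ∸ k) !))             ≡⟨ cong ((n ∸ k) *_) (nCk*k![n∸k]!≡n! (<⇒≤ k<n)) ⟩
  (n ∸ k) * n !                                     ≡⟨ cong ((n ∸ k) *_) (nCk*k![n∸k]!≡n! k<n) ⟨
  (n ∸ k) * ((n C suc k) * (suc k ! * (n ∸ suc k) !)) ≡⟨ *-Comm.x∙yz≈y∙xz (n ∸ k) (n C suc k) _ ⟩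
  (n C suc k) * ((n ∸ k) * (suc k ! * (n ∸ suc k) !)) ≡⟨ cong ((n C suc k) *_) ([n-k]*d[k+1]≡[k+1]*d[k] k<n) ⟩
  (n C suc k) * (suc k * (k ! * (n ∸ k) !))           ≡⟨ *-assoc (n C suc k) (suc k) _ ⟨
  (n C suc k) * suc k * (k ! * (n ∸ k) !)             ∎)
  where open ≡-Reasoning

ballot-suc-suc : ∀ k m → ballot (suc k) (suc m) ≡ ballot (suc k) m + ballot k (suc (suc m))
ballot-suc-suc k m = begin
  sum (applyUpTo f (suc (suc m)))                ≡⟨ cong sum (applyUpTo-∷ʳ f (suc m)) ⟨
  sum (applyUpTo f (suc m) ∷ʳ f (suc m))         ≡⟨ sum-++ (applyUpTo f (suc m)) _ ⟩
  sum (applyUpTo f (suc m)) + (f (suc m) + 0)    ≡⟨ cong (sum (applyUpTo f (suc m)) +_) (+-identityʳ _) ⟩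
  sum (applyUpTo f (suc m)) + f (suc m)          ∎
  where
  open ≡-Reasoning
  f : ℕ → ℕ
  f i = ballot k (suc i)

ballot-binomial : ∀ k m → ballot k m + (m + k + k) C⁻ k ≡ (m + k + k) C k
ballot-binomial zero    m = sym (nC0≡1 (m + 0 + 0))
ballot-binomial (suc k) zero rewrite +-suc k k = begin
  (ballot k 1 + 0) + suc K C k       ≡⟨ cong₂ _+_ (+-identityʳ (ballot k 1)) (pascal K k) ⟩
  ballot k 1 + (K C⁻ k + K C k)      ≡⟨ +-assoc (ballot k 1) _ _ ⟨
  (ballot k 1 + K C⁻ k) + K C k      ≡⟨ cong (_+ K C k) (ballot-binomial k 1) ⟩
  K C k + K C k                      ≡⟨ cong (K C k +_) (C-middle k) ⟨
  K C k + K C suc k                  ≡⟨ nCk+nC[k+1]≡[n+1]C[k+1] K k ⟩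
  suc K C suc k                      ∎
  where
  open ≡-Reasoning
  K : ℕ
  K = suc (k + k)
ballot-binomial (suc k) (suc m) = begin
  ballot (suc k) (suc m) + suc M C k
    ≡⟨ cong₂ _+_ (ballot-suc-suc k m) (pascal M k) ⟩
  (ballot (suc k) m + ballot k (2 + m)) + (M C⁻ k + M C k)
    ≡⟨ cong ((ballot (suc k) m + ballot k (2 + m)) +_) (+-comm (M C⁻ k) (M C k)) ⟩
  (ballot (suc k) m + ballot k (2 + m)) + (M C k + M C⁻ k)
    ≡⟨ interchange (ballot (suc k) m) _ _ _ ⟩
  (ballot (suc k) m + M C k) + (ballot k (2 + m) + M C⁻ k)
    ≡⟨ cong₂ _+_ (ballot-binomial (suc k) m) shifted ⟩
  M C suc k + M C k
    ≡⟨ +-comm (M C suc k) (M C k) ⟩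
  M C k + M C suc k
    ≡⟨ nCk+nC[k+1]≡[n+1]C[k+1] M k ⟩
  suc M C suc k
    ∎
  where
  open ≡-Reasoning
  M : ℕ
  M = m + suc k + suc k
  M≡ : 2 + m + k + k ≡ M
  M≡ = sym (trans (+-suc (m + suc k) k) (cong (λ x → suc (x + k)) (+-suc m k)))
  shifted : ballot k (2 + m) + M C⁻ k ≡ M C k
  shifted = subst (λ n → ballot k (2 + m) + n C⁻ k ≡ n C k) M≡ (ballot-binomial k (2 + m))

C⁻-absorb : ∀ k ℓ → ((ℓ + k + k) C⁻ k) * suc (k + ℓ) ≡ ((ℓ + k + k) C k) * k
C⁻-absorb zero    ℓ = sym (*-zeroʳ ((ℓ + 0 + 0) C 0))
C⁻-absorb (suc j) ℓ = subst (λ x → (N C j) * x ≡ (N C suc j) * suc j) N∸j≡ (C-absorb j<N)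
  where
  N : ℕ
  N = ℓ + suc j + suc j
  N≡ : ∀ a b → a + suc b + suc b ≡ b + suc (suc b + a)
  N≡ = solve-∀
  N∸j≡ : N ∸ j ≡ suc (suc j + ℓ)
  N∸j≡ = trans (cong (_∸ j) (N≡ ℓ j)) (m+n∸m≡n j _)
  j<N : j < N
  j<N = subst (j <_) (sym (N≡ ℓ j)) (m<m+n j (s≤s z≤n))

ballot-closed : ∀ k ℓ → ballot k ℓ * suc (k + ℓ) ≡ ((ℓ + k + k) C k) * (ℓ + 1)
ballot-closed k ℓ = +-cancelʳ-≡ ((N C⁻ k) * S) _ _ (begin
  ballot k ℓ * S + (N C⁻ k) * S       ≡⟨ *-distribʳ-+ S (ballot k ℓ) (N C⁻ k) ⟨
  (ballot k ℓ + N C⁻ k) * S           ≡⟨ cong (_* S) (ballot-binomial k ℓ) ⟩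
  (N C k) * S                         ≡⟨ cong ((N C k) *_) (trans (+-comm (suc k) ℓ) (sym (+-assoc ℓ 1 k))) ⟩
  (N C k) * (ℓ + 1 + k)               ≡⟨ *-distribˡ-+ (N C k) (ℓ + 1) k ⟩
  (N C k) * (ℓ + 1) + (N C k) * k     ≡⟨ cong ((N C k) * (ℓ + 1) +_) (C⁻-absorb k ℓ) ⟨
  (N C k) * (ℓ + 1) + (N C⁻ k) * S    ∎)
  where
  open ≡-Reasoning
  N S : ℕ
  N = ℓ + k + k
  S = suc (k + ℓ)

B≡ballot : ∀ k ℓ → B (k + ℓ) k ≡ ballot k ℓ
B≡ballot k ℓ = begin
  ((k + ℓ ∸ k + 1) * ((k + ℓ + k) C (k + ℓ))) / S  ≡⟨ cong₂ (λ a b → ((a + 1) * b) / S) (m+n∸m≡n k ℓ) C-symm ⟩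
  ((ℓ + 1) * ((ℓ + k + k) C k)) / S                ≡⟨ cong (_/ S) (trans (*-comm (ℓ + 1) _) (sym (ballot-closed k ℓ))) ⟩
  (ballot k ℓ * S) / S                             ≡⟨ m*n/n≡m (ballot k ℓ) S ⟩
  ballot k ℓ                                       ∎
  where
  open ≡-Reasoning
  S : ℕ
  S = suc (k + ℓ)
  C-symm : (k + ℓ + k) C (k + ℓ) ≡ (ℓ + k + k) C k
  C-symm = begin
    (k + ℓ + k) C (k + ℓ)               ≡⟨ nCk≡nC[n∸k] (m≤m+n (k + ℓ) k) ⟩
    (k + ℓ + k) C (k + ℓ + k ∸ (k + ℓ)) ≡⟨ cong ((k + ℓ + k) C_) (m+n∸m≡n (k + ℓ) k) ⟩
    (k + ℓ + k) C k                     ≡⟨ cong (λ n → (n + k) C k) (+-comm k ℓ) ⟩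
    (ℓ + k + k) C k                     ∎

proposition2p11 : (m n : ℕ) → 3 ≤ m → m ≤ n →
    (s : Struct (m ∸ 3)) → Arithmetical s → Smooth s →
    Σ (List (Struct (n ∸ 3))) λ L →
      Unique L ×
      ((t : Struct (n ∸ 3)) → (t ∈ L ⇔ (Arithmetical t × Descendant s t))) ×
      length L ≡ B (n ∸ 3) (n ∸ m)
proposition2p11 m n 3≤m m≤n s arith (_ , _ , smooth) =
  level ℓ≤ , level-unique ℓ≤ , (λ t → mk⇔ sound complete) , counted
  where
  open Descendants s smooth
  open Equivalence
  ℓ≤ : m ∸ 3 ≤′ n ∸ 3
  ℓ≤ = ≤⇒≤′ (∸-monoˡ-≤ 3 m≤n)
  k : ℕ
  k = n ∸ 3 ∸ (m ∸ 3)
  sound : ∀ {t} → t ∈ level ℓ≤ → Arithmetical t × Descendant s t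
  sound t∈ = let dst = to (∈-level⇔descendant ℓ≤) t∈ in Descendant-arithmetical arith dst , dst
  complete : ∀ {t} → Arithmetical t × Descendant s t → t ∈ level ℓ≤
  complete = from (∈-level⇔descendant ℓ≤) ∘ proj₂
  counted : length (level ℓ≤) ≡ B (n ∸ 3) (n ∸ m)
  counted = begin
    length (level ℓ≤)      ≡⟨ level-length ℓ≤ ⟩
    ballot k (m ∸ 3)       ≡⟨ B≡ballot k (m ∸ 3) ⟨
    B (k + (m ∸ 3)) k      ≡⟨ cong₂ B (m∸n+n≡m (∸-monoˡ-≤ 3 m≤n)) k≡n∸m ⟩
    B (n ∸ 3) (n ∸ m)      ∎
    where
    open ≡-Reasoning
    k≡n∸m : k ≡ n ∸ m
    k≡n∸m = trans (∸-+-assoc n 3 (m ∸ 3)) (cong (n ∸_) (m+[n∸m]≡n 3≤m))
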